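{- Let $G$ be a connected graph on $n$ vertices. For every edge $e=uv$ of $G$, letting $x_e=\frac{\deg(u)+\deg(v)}{2}$, we have $$(\deg(u)+\deg(v))\,n_u(e)\,n_v(e)\le 2\left\lfloor\frac{n^2}{4}\right\rfloor(n-x_e).$$
   Context: For an edge $e=uv$, $n_u(e)$ is the number of vertices $x$ with $d(x,u)<d(x,v)$, where $d$ is graph distance; $n_v(e)$ is defined symmetrically. -}

module Defs where

open import Data.Nat using (ℕ; zero; suc; _+_; _*_; _∸_; _<ᵇ_)
open import Data.Fin using (Fin; zero; suc)
open import Data.Bool using (Bool; true; false; if_then_else_; _∨_; _∧_)
open import Data.Product using (∃)
open import Relation.Binary.PropositionalEquality using (_≡_)

record Graph (n : ℕ) : Set where
  field
    adj   : Fin n → Fin n → Bool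
    sym   : ∀ u v → adj u v ≡ adj v u
    irrfl : ∀ u → adj u u ≡ false
open Graph public

count : ∀ {n} → (Fin n → Bool) → ℕ
count {zero}  p = 0
count {suc n} p = (if p zero then 1 else 0) + count (λ i → p (suc i))

anyF : ∀ {n} → (Fin n → Bool) → Bool
anyF {zero}  p = false
anyF {suc n} p = p zero ∨ anyF (λ i → p (suc i))

deg : ∀ {n} → Graph n → Fin n → ℕ
deg G u = count (λ v → adj G u v)

_==F_ : ∀ {n} → Fin n → Fin n → Bool
zero  ==F zero  = true
zero  ==F suc _ = false
suc _ ==F zero  = false
suc i ==F suc j = i ==F j

within : ∀ {n} → Graph n → ℕ → Fin n → Fin n → Bool
within G zero    x y = x ==F y
within G (suc k) x y = within G k x y ∨ anyF (λ z → within G k x z ∧ adj G z y)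

Connected : ∀ {n} → Graph n → Set
Connected G = ∀ x y → ∃ λ k → within G k x y ≡ true

search : ∀ {n} → Graph n → Fin n → Fin n → ℕ → ℕ → ℕ
search G x y k zero       = k
search G x y k (suc fuel) = if within G k x y then k else search G x y (suc k) fuel

-- graph distance d(x,y): the least length of a walk from x to y.
-- (In a connected graph on n vertices it is < n, so the search with fuel n
-- always finds it.)
dist : ∀ {n} → Graph n → Fin n → Fin n → ℕ
dist {n} G x y = search G x y 0 n

nCloser : ∀ {n} → Graph n → Fin n → Fin n → ℕ
nCloser G u v = count (λ x → dist G x u <ᵇ dist G x v)

-- Let c be the number of common neighbours of u and v.  Two counting facts
-- drive the proof:
--   (1) a + b + c ≤ n, because a common neighbour x has d(x,u) = d(x,v) = 1,
--       so the three sets counted by a, b, c are pairwise disjoint;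
--   (2) d ≤ n + c, by inclusion–exclusion on the two neighbourhoods.
-- Together they give d + (a + b) ≤ 2n, so d ≤ (n − a) + (n − b) and
-- a + b ≤ 2n − d.  Hence
--   d·a·b ≤ b·a(n − a) + a·b(n − b) ≤ (a + b)·⌊n²/4⌋ ≤ (2n − d)·⌊n²/4⌋,
-- using x(n − x) ≤ ⌊n²/4⌋ (AM–GM).
module Submission where

open import Defs hiding (sym)
open import Data.Nat using (ℕ; zero; suc; _+_; _*_; _∸_; _≤_; _<ᵇ_; s≤s)
open import Data.Nat.Properties
open import Data.Nat.DivMod using (_/_; m*n/n≡m; /-monoˡ-≤)
open import Data.Nat.Tactic.RingSolver using (solve-∀)
open import Data.Fin using (Fin; zero; suc)
open import Data.Bool using (Bool; true; false; if_then_else_; _∨_; _∧_)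
open import Data.Bool.Properties using (∨-zeroʳ; ∧-zeroʳ)
open import Data.Sum using (inj₁; inj₂)
open import Data.Product using (_,_)
open import Relation.Binary.PropositionalEquality
  using (_≡_; refl; sym; trans; cong; subst; subst₂; module ≡-Reasoning)

-- AM–GM in ℕ, 4xy ≤ (x + y)², for x ≤ y: writing y = x + k, (x + y)² = 4xy + k².
amgm-ordered : ∀ {x y} → x ≤ y → x * y * 4 ≤ (x + y) * (x + y)
amgm-ordered {x} x≤y with m≤n⇒∃[o]m+o≡n x≤y
... | k , refl = subst (x * (x + k) * 4 ≤_) (sym (square-split x k)) (m≤m+n _ (k * k))
  where
  square-split : ∀ x k → (x + (x + k)) * (x + (x + k)) ≡ x * (x + k) * 4 + k * k
  square-split = solve-∀

amgm : ∀ x y → x * y * 4 ≤ (x + y) * (x + y)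
amgm x y with ≤-total x y
... | inj₁ x≤y = amgm-ordered x≤y
... | inj₂ y≤x = subst₂ _≤_ (cong (_* 4) (*-comm y x)) (cong (λ s → s * s) (+-comm y x))
                   (amgm-ordered y≤x)

product≤quarter-square : ∀ {n} x → x ≤ n → x * (n ∸ x) ≤ n * n / 4
product≤quarter-square x x≤n with m≤n⇒∃[o]m+o≡n x≤n
... | k , refl = begin
    x * (x + k ∸ x)     ≡⟨ cong (x *_) (m+n∸m≡n x k) ⟩
    x * k               ≡⟨ sym (m*n/n≡m (x * k) 4) ⟩
    x * k * 4 / 4       ≤⟨ /-monoˡ-≤ 4 (amgm x k) ⟩
    (x + k) * (x + k) / 4 ∎
  where open ≤-Reasoning

double∸sum : ∀ {n a b} → a ≤ n → b ≤ n → 2 * n ∸ (a + b) ≡ (n ∸ a) + (n ∸ b)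
double∸sum {n} {a} {b} a≤n b≤n = begin
    2 * n ∸ (a + b)       ≡⟨ cong (_∸ (a + b)) (cong (n +_) (+-identityʳ n)) ⟩
    n + n ∸ (a + b)       ≡⟨ sym (∸-+-assoc (n + n) a b) ⟩
    n + n ∸ a ∸ b         ≡⟨ cong (_∸ b) (+-∸-comm n a≤n) ⟩
    (n ∸ a) + n ∸ b       ≡⟨ +-∸-assoc (n ∸ a) b≤n ⟩
    (n ∸ a) + (n ∸ b)     ∎
  where open ≡-Reasoning

weighted-product-bound : ∀ n a b d → a ≤ n → b ≤ n → d + (a + b) ≤ 2 * n →
  d * a * b ≤ (n * n / 4) * (2 * n ∸ d)
weighted-product-bound n a b d a≤n b≤n total = begin
    d * a * b                         ≤⟨ *-monoˡ-≤ b (*-monoˡ-≤ a d≤gaps) ⟩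
    ((n ∸ a) + (n ∸ b)) * a * b       ≡⟨ expand (n ∸ a) (n ∸ b) a b ⟩
    b * (a * (n ∸ a)) + a * (b * (n ∸ b))
      ≤⟨ +-mono-≤ (*-monoʳ-≤ b (product≤quarter-square a a≤n))
                  (*-monoʳ-≤ a (product≤quarter-square b b≤n)) ⟩
    b * N + a * N                     ≡⟨ collect N a b ⟩
    N * (a + b)                       ≤⟨ *-monoʳ-≤ N a+b≤rest ⟩
    N * (2 * n ∸ d)                   ∎
  where
  open ≤-Reasoning
  N = n * n / 4
  d≤gaps : d ≤ (n ∸ a) + (n ∸ b)
  d≤gaps = subst (d ≤_) (double∸sum a≤n b≤n) (m+n≤o⇒m≤o∸n d total)
  a+b≤rest : a + b ≤ 2 * n ∸ d
  a+b≤rest = m+n≤o⇒m≤o∸n (a + b) (subst (_≤ 2 * n) (+-comm d (a + b)) total)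
  expand : ∀ p q a b → (p + q) * a * b ≡ b * (a * p) + a * (b * q)
  expand = solve-∀
  collect : ∀ N a b → b * N + a * N ≡ N * (a + b)
  collect = solve-∀

count≤ : ∀ {n} (p : Fin n → Bool) → count p ≤ n
count≤ {zero}  p = ≤-refl
count≤ {suc n} p with p zero
... | true  = s≤s (count≤ (λ i → p (suc i)))
... | false = m≤n⇒m≤1+n (count≤ (λ i → p (suc i)))

count-inclusion-exclusion : ∀ {n} (p q : Fin n → Bool) →
  count p + count q ≡ count (λ i → p i ∨ q i) + count (λ i → p i ∧ q i)
count-inclusion-exclusion {zero} p q = refl
count-inclusion-exclusion {suc n} p q
  with p zero | q zero | count-inclusion-exclusion (λ i → p (suc i)) (λ i → q (suc i))
... | true  | true  | ih = cong suc (trans (+-suc _ _) (trans (cong suc ih) (sym (+-suc _ _))))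
... | true  | false | ih = cong suc ih
... | false | true  | ih = trans (+-suc _ _) (cong suc ih)
... | false | false | ih = ih

count-none : ∀ {n} (p : Fin n → Bool) → (∀ i → p i ≡ false) → count p ≡ 0
count-none {zero}  p never = refl
count-none {suc n} p never rewrite never zero = count-none (λ i → p (suc i)) (λ i → never (suc i))

count-disjoint : ∀ {n} (p q : Fin n → Bool) → (∀ i → (p i ∧ q i) ≡ false) →
  count p + count q ≡ count (λ i → p i ∨ q i)
count-disjoint {n} p q disjoint = begin
    count p + count q                                   ≡⟨ count-inclusion-exclusion p q ⟩
    count p∪q + count (λ i → p i ∧ q i)                 ≡⟨ cong (count p∪q +_) (count-none _ disjoint) ⟩
    count p∪q + 0                                       ≡⟨ +-identityʳ _ ⟩
    count p∪q                                           ∎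
  where
  open ≡-Reasoning
  p∪q : Fin n → Bool
  p∪q i = p i ∨ q i

anyF-intro : ∀ {n} (p : Fin n → Bool) (i : Fin n) → p i ≡ true → anyF p ≡ true
anyF-intro p zero    pi≡true rewrite pi≡true = refl
anyF-intro p (suc i) pi≡true rewrite anyF-intro (λ j → p (suc j)) i pi≡true = ∨-zeroʳ (p zero)

==F-refl : ∀ {n} (x : Fin n) → (x ==F x) ≡ true
==F-refl zero    = refl
==F-refl (suc x) = ==F-refl x

==F-sound : ∀ {n} (x y : Fin n) → (x ==F y) ≡ true → x ≡ y
==F-sound zero    zero    _  = refl
==F-sound (suc x) (suc y) eq = cong suc (==F-sound x y eq)

-- Adjacent vertices are distinct (irreflexivity), so no walk of length 0 joins them …
adjacent⇒¬within0 : ∀ {n} (G : Graph n) x y → adj G x y ≡ true → within G 0 x y ≡ false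
adjacent⇒¬within0 G x y xy with x ==F y in x≡y
... | false = refl
... | true with ==F-sound x y x≡y
...   | refl with trans (sym xy) (irrfl G x)
...     | ()

adjacent⇒within1 : ∀ {n} (G : Graph n) x y → adj G x y ≡ true → within G 1 x y ≡ true
adjacent⇒within1 G x y xy =
  trans (cong (x ==F y ∨_) (anyF-intro (λ z → (x ==F z) ∧ adj G z y) x xx-edge)) (∨-zeroʳ _)
  where
  xx-edge : ((x ==F x) ∧ adj G x y) ≡ true
  xx-edge rewrite ==F-refl x = xy

search-stops : ∀ {n} (G : Graph n) x y k fuel →
  within G k x y ≡ false → within G (suc k) x y ≡ true → search G x y k (suc (suc fuel)) ≡ suc k
search-stops G x y k fuel not-k reach = step (within G k x y) (within G (suc k) x y) not-k reach
  where
  step : ∀ b₀ b₁ → b₀ ≡ false → b₁ ≡ true →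
    (if b₀ then k else (if b₁ then suc k else search G x y (suc (suc k)) fuel)) ≡ suc k
  step .false .true refl refl = refl

-- A graph with an edge has at least two vertices, enough fuel for the search to reach 1.
adjacent⇒dist≡1 : ∀ {n} (G : Graph n) x y → adj G x y ≡ true → dist G x y ≡ 1
adjacent⇒dist≡1 {suc zero} G zero zero xy with trans (sym xy) (irrfl G zero)
... | ()
adjacent⇒dist≡1 {suc (suc m)} G x y xy =
  search-stops G x y 0 m (adjacent⇒¬within0 G x y xy) (adjacent⇒within1 G x y xy)

commonNeighbours : ∀ {n} → Graph n → Fin n → Fin n → ℕ
commonNeighbours G u v = count (λ x → adj G u x ∧ adj G v x)

closer : ∀ {n} → Graph n → Fin n → Fin n → Fin n → Bool
closer G u v x = dist G x u <ᵇ dist G x v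

<ᵇ-asym : ∀ m k → ((m <ᵇ k) ∧ (k <ᵇ m)) ≡ false
<ᵇ-asym zero    zero    = refl
<ᵇ-asym zero    (suc k) = refl
<ᵇ-asym (suc m) zero    = refl
<ᵇ-asym (suc m) (suc k) = <ᵇ-asym m k

-- A common neighbour x has d(x,u) = 1 = d(x,v), so it is closer to neither.
common-neighbour-equidistant : ∀ {n} (G : Graph n) u v x →
  ((closer G u v x ∨ closer G v u x) ∧ (adj G u x ∧ adj G v x)) ≡ false
common-neighbour-equidistant G u v x with adj G u x in ux | adj G v x in vx
... | true  | true  rewrite adjacent⇒dist≡1 G x u (trans (Graph.sym G x u) ux)
                          | adjacent⇒dist≡1 G x v (trans (Graph.sym G x v) vx) = refl
... | true  | false = ∧-zeroʳ _
... | false | _     = ∧-zeroʳ _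

closer-common-bound : ∀ {n} (G : Graph n) u v →
  nCloser G u v + nCloser G v u + commonNeighbours G u v ≤ n
closer-common-bound {n} G u v = subst (_≤ n) (sym three-disjoint-sets) (count≤ _)
  where
  open ≡-Reasoning
  C : Fin n → Bool
  C x = adj G u x ∧ adj G v x
  three-disjoint-sets : nCloser G u v + nCloser G v u + count C
                      ≡ count (λ x → (closer G u v x ∨ closer G v u x) ∨ C x)
  three-disjoint-sets = begin
    nCloser G u v + nCloser G v u + count C
      ≡⟨ cong (_+ count C) (count-disjoint (closer G u v) (closer G v u)
                              (λ x → <ᵇ-asym (dist G x u) (dist G x v))) ⟩
    count (λ x → closer G u v x ∨ closer G v u x) + count C
      ≡⟨ count-disjoint _ C (common-neighbour-equidistant G u v) ⟩
    count (λ x → (closer G u v x ∨ closer G v u x) ∨ C x) ∎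

degree-sum-bound : ∀ {n} (G : Graph n) u v → deg G u + deg G v ≤ n + commonNeighbours G u v
degree-sum-bound {n} G u v =
  subst (_≤ n + commonNeighbours G u v) (sym (count-inclusion-exclusion (adj G u) (adj G v)))
        (+-monoˡ-≤ (commonNeighbours G u v) (count≤ _))

proposition22 : (n : ℕ) (G : Graph n) → Connected G → (u v : Fin n) → adj G u v ≡ true →
    (deg G u + deg G v) * nCloser G u v * nCloser G v u
      ≤ ((n * n) / 4) * ((2 * n) ∸ (deg G u + deg G v))
proposition22 n G _ u v _ = weighted-product-bound n a b d a≤n b≤n degrees-and-closer
  where
  open ≤-Reasoning
  a = nCloser G u v
  b = nCloser G v u
  c = commonNeighbours G u v
  d = deg G u + deg G v
  partition : a + b + c ≤ n
  partition = closer-common-bound G u v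
  a≤n : a ≤ n
  a≤n = m+n≤o⇒m≤o a (m+n≤o⇒m≤o (a + b) partition)
  b≤n : b ≤ n
  b≤n = m+n≤o⇒n≤o a (m+n≤o⇒m≤o (a + b) partition)
  degrees-and-closer : d + (a + b) ≤ 2 * n
  degrees-and-closer = begin
    d + (a + b)       ≤⟨ +-monoˡ-≤ (a + b) (degree-sum-bound G u v) ⟩
    n + c + (a + b)   ≡⟨ regroup n c a b ⟩
    n + (a + b + c)   ≤⟨ +-monoʳ-≤ n partition ⟩
    n + n             ≡⟨ cong (n +_) (sym (+-identityʳ n)) ⟩
    2 * n             ∎
    where
    regroup : ∀ n c a b → n + c + (a + b) ≡ n + (a + b + c)
    regroup = solve-∀
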